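{- Let $K$ be a fully chain-complete semiring, $\tau$ a finite relational vocabulary, $A$ a finite universe and $\pi:\mathrm{Lit}_A(\tau)\to K$ a $K$-interpretation. Then the semiring semantics of LFP is well-defined: for every LFP formula all least and greatest fixed points of update operators $F^\varphi_\pi$ required by the defining rules exist, so that $\pi[\![\psi]\!]\in K$ is well-defined for every LFP-sentence $\psi$ (with parameters from $A$).
   Context: A semiring is a commutative semiring $(K,+,\cdot,0,1)$, $0\ne1$, that is naturally ordered ($a\le b:\iff \exists c\,a+c=b$ is a partial order). $K$ is fully chain-complete if every chain $C\subseteq K$ has a supremum and an infimum in $K$. $\mathrm{Lit}_A(\tau)$ consists of atoms $R\bar a$ ($R\in\tau$, $\bar a\in A^{\mathrm{arity}(R)}$), their negations, and all $a=b$, $a\ne b$ with $a,b\in A$. A $K$-interpretation maps literals to $K$, true (in)equalities to $1$ and false ones to $0$. LFP extends first-order logic by $[\mathbf{lfp}\,R\bar x.\varphi](\bar x)$ and $[\mathbf{gfp}\,R\bar x.\varphi](\bar x)$ where $R$ occurs only positively in $\varphi$. Valuation rules: $\pi[\![\alpha\vee\beta]\!]=\pi[\![\alpha]\!]+\pi[\![\beta]\!]$, $\pi[\![\alpha\wedge\beta]\!]=\pi[\![\alpha]\!]\cdot\pi[\![\beta]\!]$, $\pi[\![\exists x\alpha(x)]\!]=\sum_{a\in A}\pi[\![\alpha(a)]\!]$, $\pi[\![\forall x\alpha(x)]\!]=\prod_{a\in A}\pi[\![\alpha(a)]\!]$, $\pi[\![\neg\alpha]\!]=\pi[\![\mathrm{nnf}(\neg\alpha)]\!]$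 (negation normal form, obtained via de Morgan laws and the lfp/gfp duality), literals evaluated by $\pi$. For $\varphi(R,\bar x)$ with $R$ of arity $m$, functions $g:A^m\to K$ are ordered pointwise, $\pi[R\mapsto g]$ extends $\pi$ by the values $g(\bar c)$ for atoms $R\bar c$, $F^\varphi_\pi(g)(\bar a)=\pi[R\mapsto g][\![\varphi(R,\bar a)]\!]$, and $\pi[\![[\mathbf{lfp}\,R\bar x.\varphi](\bar a)]\!]=\mathrm{lfp}(F^\varphi_\pi)(\bar a)$, $\pi[\![[\mathbf{gfp}\,R\bar x.\varphi](\bar a)]\!]=\mathrm{gfp}(F^\varphi_\pi)(\bar a)$. -}

module Defs where

open import Level using (Level; _⊔_; Setω)
open import Algebra.Bundles using (CommutativeSemiring; Monoid; RawMonoid)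
import Algebra.Definitions.RawMonoid as RM
open import Data.Nat using (ℕ; suc) renaming (_+_ to _ℕ+_)
open import Data.Fin using (Fin)
open import Data.Vec using (Vec; _∷_; []; _++_; lookup; map)
open import Data.List using (List; _∷_)
open import Data.List.Membership.Propositional using (_∈_)
open import Data.List.Relation.Unary.All as All using (All; _∷_)
open import Data.Product using (Σ; ∃; _×_; _,_)
open import Data.Sum using (_⊎_)
open import Relation.Nullary using (¬_)
open import Relation.Binary.PropositionalEquality using (_≡_; _≢_)

module _ {c ℓ} (K : CommutativeSemiring c ℓ) where
  open CommutativeSemiring K

  _≼_ : Carrier → Carrier → Set (c ⊔ ℓ)
  a ≼ b = ∃ λ d → (a + d) ≈ b

  -- the paper's notion of "semiring": commutative semiring with 0 ≠ 1
  -- whose natural (pre)order is a partial order (antisymmetric)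
  IsNaturallyOrdered : Set (c ⊔ ℓ)
  IsNaturallyOrdered = ∀ a b → a ≼ b → b ≼ a → a ≈ b

  ZeroNotOne : Set ℓ
  ZeroNotOne = ¬ (0# ≈ 1#)

  IsChain : ∀ {p} → (Carrier → Set p) → Set (c ⊔ ℓ ⊔ p)
  IsChain C = ∀ a b → C a → C b → (a ≼ b) ⊎ (b ≼ a)

  IsSup : ∀ {p} → (Carrier → Set p) → Carrier → Set (c ⊔ ℓ ⊔ p)
  IsSup C s = (∀ a → C a → a ≼ s) × (∀ u → (∀ a → C a → a ≼ u) → s ≼ u)

  IsInf : ∀ {p} → (Carrier → Set p) → Carrier → Set (c ⊔ ℓ ⊔ p)
  IsInf C s = (∀ a → C a → s ≼ a) × (∀ u → (∀ a → C a → u ≼ a) → u ≼ s)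

  FullyChainComplete : Setω
  FullyChainComplete = ∀ {p} (C : Carrier → Set p) → IsChain C →
                       (∃ λ s → IsSup C s) × (∃ λ i → IsInf C i)

  ∑ : ∀ {N} → (Fin N → Carrier) → Carrier
  ∑ = RM.sum (Monoid.rawMonoid +-monoid)

  ∏ : ∀ {N} → (Fin N → Carrier) → Carrier
  ∏ = RM.sum (Monoid.rawMonoid *-monoid)

-- A finite relational vocabulary τ: r relation symbols (Fin r) with arities.
-- The finite universe A is Fin N.

data Lit (N r : ℕ) (ar : Fin r → ℕ) : Set where
  pos : (R : Fin r) → Vec (Fin N) (ar R) → Lit N r ar
  neg : (R : Fin r) → Vec (Fin N) (ar R) → Lit N r ar
  eqL : Fin N → Fin N → Lit N r ar
  neqL : Fin N → Fin N → Lit N r ar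

module _ {c ℓ} (K : CommutativeSemiring c ℓ) (N r : ℕ) (ar : Fin r → ℕ) where
  open CommutativeSemiring K

  IsKInterpretation : (Lit N r ar → Carrier) → Set ℓ
  IsKInterpretation π =
    (∀ a b → (a ≡ b → π (eqL a b) ≈ 1#) × (a ≢ b → π (eqL a b) ≈ 0#)) ×
    (∀ a b → (a ≡ b → π (neqL a b) ≈ 0#) × (a ≢ b → π (neqL a b) ≈ 1#))

data Term (N n : ℕ) : Set where
  var : Fin n → Term N n
  par : Fin N → Term N n

-- Formulas with n free element variables (de Bruijn, Fin n) and a
-- context Δ of free fixed-point relation variables (listed by arity).
-- Fixed-point relation variables occur only positively (no negated
-- relation-variable atoms).  Negation is the defined operation nnf.
-- In  lfp m φ t̄ / gfp m φ t̄  the body φ has element variables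
-- x̄ (the first m) followed by the n outer ones, and the bound relation
-- variable R (arity m) is the head of its relation context.
data Formula (N r : ℕ) (ar : Fin r → ℕ) : ℕ → List ℕ → Set where
  rel  : ∀ {n Δ} (R : Fin r) → Vec (Term N n) (ar R) → Formula N r ar n Δ
  nrel : ∀ {n Δ} (R : Fin r) → Vec (Term N n) (ar R) → Formula N r ar n Δ
  eq   : ∀ {n Δ} → Term N n → Term N n → Formula N r ar n Δ
  neq  : ∀ {n Δ} → Term N n → Term N n → Formula N r ar n Δ
  rvar : ∀ {n Δ k} → k ∈ Δ → Vec (Term N n) k → Formula N r ar n Δ
  _∨_  : ∀ {n Δ} → Formula N r ar n Δ → Formula N r ar n Δ → Formula N r ar n Δ
  _∧_  : ∀ {n Δ} → Formula N r ar n Δ → Formula N r ar n Δ → Formula N r ar n Δ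
  ex   : ∀ {n Δ} → Formula N r ar (suc n) Δ → Formula N r ar n Δ
  all  : ∀ {n Δ} → Formula N r ar (suc n) Δ → Formula N r ar n Δ
  lfp  : ∀ {n Δ} (m : ℕ) → Formula N r ar (m ℕ+ n) (m ∷ Δ) →
         Vec (Term N n) m → Formula N r ar n Δ
  gfp  : ∀ {n Δ} (m : ℕ) → Formula N r ar (m ℕ+ n) (m ∷ Δ) →
         Vec (Term N n) m → Formula N r ar n Δ

module Semantics {c ℓ} (K : CommutativeSemiring c ℓ) (N r : ℕ) (ar : Fin r → ℕ)
                 (π : Lit N r ar → CommutativeSemiring.Carrier K) where
  open CommutativeSemiring K

  RVal : ℕ → Set c
  RVal k = Vec (Fin N) k → Carrier

  REnv : List ℕ → Set c
  REnv Δ = All RVal Δ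

  Env : ℕ → Set
  Env n = Vec (Fin N) n

  ⟦_⟧t : ∀ {n} → Term N n → Env n → Fin N
  ⟦ var x ⟧t ρ = lookup ρ x
  ⟦ par a ⟧t ρ = a

  ⟦_⟧ts : ∀ {n k} → Vec (Term N n) k → Env n → Vec (Fin N) k
  ⟦ ts ⟧ts ρ = map (λ t → ⟦ t ⟧t ρ) ts

  _≤f_ : ∀ {m} → RVal m → RVal m → Set (c ⊔ ℓ)
  g ≤f h = ∀ ā → _≼_ K (g ā) (h ā)

  IsFixedPoint : ∀ {m} → (RVal m → RVal m) → RVal m → Set ℓ
  IsFixedPoint F g = ∀ ā → F g ā ≈ g ā

  IsLeastFixedPoint : ∀ {m} → (RVal m → RVal m) → RVal m → Set (c ⊔ ℓ)
  IsLeastFixedPoint F g = IsFixedPoint F g × (∀ h → IsFixedPoint F h → g ≤f h)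

  IsGreatestFixedPoint : ∀ {m} → (RVal m → RVal m) → RVal m → Set (c ⊔ ℓ)
  IsGreatestFixedPoint F g = IsFixedPoint F g × (∀ h → IsFixedPoint F h → h ≤f g)

  SemFun : ℕ → List ℕ → Set c
  SemFun n Δ = REnv Δ → Env n → Carrier

  Update : ∀ {n m Δ} → SemFun (m ℕ+ n) (m ∷ Δ) → REnv Δ → Env n → RVal m → RVal m
  Update fφ σ ρ g ā = fφ (g ∷ σ) (ā ++ ρ)

  -- IsSem φ f : f satisfies the defining valuation rules of φ (in
  -- particular all required least / greatest fixed points exist)
  IsSem : ∀ {n Δ} → Formula N r ar n Δ → SemFun n Δ → Set (c ⊔ ℓ)
  IsSem (rel R ts) f = ∀ σ ρ → f σ ρ ≈ π (pos R (⟦ ts ⟧ts ρ))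
  IsSem (nrel R ts) f = ∀ σ ρ → f σ ρ ≈ π (neg R (⟦ ts ⟧ts ρ))
  IsSem (eq s t) f = ∀ σ ρ → f σ ρ ≈ π (eqL (⟦ s ⟧t ρ) (⟦ t ⟧t ρ))
  IsSem (neq s t) f = ∀ σ ρ → f σ ρ ≈ π (neqL (⟦ s ⟧t ρ) (⟦ t ⟧t ρ))
  IsSem (rvar X ts) f = ∀ σ ρ → f σ ρ ≈ All.lookup σ X (⟦ ts ⟧ts ρ)
  IsSem (φ ∨ ψ) f = Σ (SemFun _ _) λ fφ → Σ (SemFun _ _) λ fψ →
    IsSem φ fφ × IsSem ψ fψ × (∀ σ ρ → f σ ρ ≈ fφ σ ρ + fψ σ ρ)
  IsSem (φ ∧ ψ) f = Σ (SemFun _ _) λ fφ → Σ (SemFun _ _) λ fψ →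
    IsSem φ fφ × IsSem ψ fψ × (∀ σ ρ → f σ ρ ≈ fφ σ ρ * fψ σ ρ)
  IsSem (ex φ) f = Σ (SemFun _ _) λ fφ →
    IsSem φ fφ × (∀ σ ρ → f σ ρ ≈ ∑ K (λ a → fφ σ (a ∷ ρ)))
  IsSem (all φ) f = Σ (SemFun _ _) λ fφ →
    IsSem φ fφ × (∀ σ ρ → f σ ρ ≈ ∏ K (λ a → fφ σ (a ∷ ρ)))
  IsSem (lfp m φ ts) f = Σ (SemFun _ _) λ fφ →
    IsSem φ fφ × (∀ σ ρ → Σ (RVal m) λ g →
      IsLeastFixedPoint (Update fφ σ ρ) g × f σ ρ ≈ g (⟦ ts ⟧ts ρ))
  IsSem (gfp m φ ts) f = Σ (SemFun _ _) λ fφ →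
    IsSem φ fφ × (∀ σ ρ → Σ (RVal m) λ g →
      IsGreatestFixedPoint (Update fφ σ ρ) g × f σ ρ ≈ g (⟦ ts ⟧ts ρ))

module Submission where

-- Every formula denotes a function of the values of its free relation
-- variables that is monotone for the natural order, because all semiring
-- operations are monotone and relation variables occur only positively.
-- Hence each update operator is a monotone map on the functions A^m → K,
-- which are chain-complete pointwise, and such a map has a least fixed point
-- (and dually a greatest one): the least set of functions closed under the
-- operator and under suprema of chains is itself a chain, and its supremum
-- is the least prefixed point.  Least (greatest) fixed points again depend
-- monotonically on the remaining relation variables, so the induction goes
-- through the fixed-point constructors.

open import Level using (0ℓ; _⊔_) renaming (suc to lsuc)
open import Axiom.ExcludedMiddle using (ExcludedMiddle)
open import Axiom.DoubleNegationElimination using (em⇒dne)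
open import Algebra.Bundles using (CommutativeSemiring; RawMonoid)
import Algebra.Definitions.RawMonoid as RawMonoidDefinitions
open import Data.Nat using (ℕ; zero; suc) renaming (_+_ to _ℕ+_)
open import Data.Fin using (Fin; zero; suc)
open import Data.List using (_∷_)
open import Data.List.Membership.Propositional using (_∈_)
open import Data.List.Relation.Unary.All as All using (_∷_)
open import Data.List.Relation.Unary.Any using (here; there)
open import Data.Vec using (_++_; _∷_)
open import Data.Product using (Σ; ∃; _×_; _,_; proj₁; proj₂)
open import Data.Sum using (_⊎_; inj₁; inj₂; swap)
open import Data.Empty using (⊥-elim)
open import Function using (flip)
open import Relation.Nullary using (¬_; yes; no)
open import Relation.Nullary.Decidable using (True; toWitness; fromWitness)
open import Relation.Binary.Core using (Rel)
open import Relation.Binary.Definitions using (Reflexive; Transitive)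
open import Relation.Binary.PropositionalEquality as ≡ using (_≡_)
open import Relation.Unary using (Pred)
open import Defs hiding (_≼_; IsChain; IsSup; IsInf)
import Defs

module _ {x l} {X : Set x} (_≤_ : Rel X l) where

  IsChain : ∀ {p} → Pred X p → Set (x ⊔ l ⊔ p)
  IsChain C = ∀ a b → C a → C b → (a ≤ b) ⊎ (b ≤ a)

  IsSup : ∀ {p} → Pred X p → X → Set (x ⊔ l ⊔ p)
  IsSup C s = (∀ a → C a → a ≤ s) × (∀ u → (∀ a → C a → a ≤ u) → s ≤ u)

  ChainComplete : ∀ p → Set (x ⊔ l ⊔ lsuc p)
  ChainComplete p = (C : Pred X p) → IsChain C → ∃ (IsSup C)

  IsLeastPrefixedPoint : (X → X) → X → Set (x ⊔ l)
  IsLeastPrefixedPoint f m = f m ≤ m × (∀ y → f y ≤ y → m ≤ y)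

module _ {x l} {X : Set x} {_≤_ : Rel X l} where

  flip-isChain : ∀ {p} {C : Pred X p} → IsChain _≤_ C → IsChain (flip _≤_) C
  flip-isChain chain a b ca cb = swap (chain a b ca cb)

  chainComplete-pointwise : ∀ {i p} {I : Set i} → ChainComplete _≤_ (i ⊔ x ⊔ p) →
                            ChainComplete {X = I → X} (λ f g → ∀ a → f a ≤ g a) p
  chainComplete-pointwise {I = I} complete C chain =
    (λ a → proj₁ (sup a)) ,
    (λ f cf a → proj₁ (proj₂ (sup a)) (f a) (f , cf , ≡.refl)) ,
    (λ u below a → proj₂ (proj₂ (sup a)) (u a) λ { _ (f , cf , ≡.refl) → below f cf a })
    where
      values : I → Pred X _
      values a v = ∃ λ f → C f × f a ≡ v

      values-chain : ∀ a → IsChain _≤_ (values a)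
      values-chain a _ _ (f , cf , ≡.refl) (g , cg , ≡.refl) with chain f g cf cg
      ... | inj₁ f≤g = inj₁ (f≤g a)
      ... | inj₂ g≤f = inj₂ (g≤f a)

      sup : ∀ a → ∃ (IsSup _≤_ (values a))
      sup a = complete (values a) (values-chain a)

module _ {x l} {X : Set x} {_≤_ : Rel X l} {f : X → X} {m : X} where

  leastPrefixedPoint-postfixed : (∀ {a b} → a ≤ b → f a ≤ f b) →
                                 IsLeastPrefixedPoint _≤_ f m → m ≤ f m
  leastPrefixedPoint-postfixed mono (fm≤m , least) = least (f m) (mono fm≤m)

  leastPrefixedPoint-mono : Transitive _≤_ → ∀ {g n} → (∀ a → f a ≤ g a) →
                            IsLeastPrefixedPoint _≤_ f m → IsLeastPrefixedPoint _≤_ g n → m ≤ n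
  leastPrefixedPoint-mono ≤-trans {n = n} f≤g (_ , least) (gn≤n , _) =
    least n (≤-trans (f≤g n) gn≤n)

module MonotoneFixedPoint (em : ∀ {a} → ExcludedMiddle a)
  {x l} {X : Set x} {_≤_ : Rel X l} (≤-trans : Transitive _≤_)
  (complete : ChainComplete _≤_ 0ℓ)
  {f : X → X} (mono : ∀ {a b} → a ≤ b → f a ≤ f b) where

  private
    dne : ∀ {a} {P : Set a} → ¬ ¬ P → P
    dne = em⇒dne em

    -- Excluded middle resizes propositions into Set, so predicates mentioning
    -- the tower, which quantifies over all predicates in Set, can be fed back
    -- into that quantification.
    Resize : ∀ {a} → Set a → Set
    Resize P = True (em {P = P})

  Admissible : Pred X 0ℓ → Set (lsuc 0ℓ ⊔ x ⊔ l)
  Admissible S = (∀ a → S a → S (f a)) ×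
                 ((C : Pred X 0ℓ) → (∀ a → C a → S a) → IsChain _≤_ C → ∀ s → IsSup _≤_ C s → S s)

  Tower : Pred X (lsuc 0ℓ ⊔ x ⊔ l)
  Tower a = ∀ S → Admissible S → S a

  tower-f : ∀ {a} → Tower a → Tower (f a)
  tower-f {a} ta S admissible = proj₁ admissible a (ta S admissible)

  tower-sup : (C : Pred X 0ℓ) → (∀ a → C a → Tower a) → IsChain _≤_ C → ∀ s → IsSup _≤_ C s → Tower s
  tower-sup C C⊆tower chain s sup S admissible =
    proj₂ admissible C (λ a ca → C⊆tower a ca S admissible) chain s sup

  tower-ind : ∀ {p} (P : Pred X p) →
              (∀ a → Tower a → P a → P (f a)) →
              ((C : Pred X 0ℓ) → (∀ a → C a → Tower a × P a) → IsChain _≤_ C → ∀ s → IsSup _≤_ C s → P s) →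
              ∀ a → Tower a → P a
  tower-ind P step limit a ta = proj₂ (toWitness (ta S (closed-f , closed-sup)))
    where
      S : Pred X 0ℓ
      S b = Resize (Tower b × P b)

      closed-f : ∀ b → S b → S (f b)
      closed-f b sb with toWitness sb
      ... | tb , pb = fromWitness (tower-f tb , step b tb pb)

      closed-sup : (C : Pred X 0ℓ) → (∀ b → C b → S b) → IsChain _≤_ C → ∀ s → IsSup _≤_ C s → S s
      closed-sup C C⊆S chain s sup = fromWitness
        (tower-sup C (λ b cb → proj₁ (toWitness (C⊆S b cb))) chain s sup ,
         limit C (λ b cb → toWitness (C⊆S b cb)) chain s sup)

  sup-not-below : ∀ {p} {C : Pred X p} {s u} → IsSup _≤_ C s → ¬ (s ≤ u) → ∃ λ a → C a × ¬ (a ≤ u)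
  sup-not-below {u = u} (_ , least) s≰u =
    dne λ none → s≰u (least u λ a ca → dne λ a≰u → none (a , ca , a≰u))

  tower-inflationary : ∀ a → Tower a → a ≤ f a
  tower-inflationary = tower-ind (λ a → a ≤ f a) (λ _ _ → mono)
    λ C ih _ s (upper , least) → least (f s) λ a ca → ≤-trans (proj₂ (ih a ca)) (mono (upper a ca))

  _<_ : Rel X l
  a < b = a ≤ b × ¬ (b ≤ a)

  IsExtreme : Pred X (lsuc 0ℓ ⊔ x ⊔ l)
  IsExtreme c = ∀ a → Tower a → a < c → f a ≤ c

  extreme-splits : ∀ {c} → IsExtreme c → ∀ a → Tower a → (a ≤ c) ⊎ (f c ≤ a)
  extreme-splits {c} c-extreme = tower-ind (λ a → (a ≤ c) ⊎ (f c ≤ a)) step limit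
    where
      step : ∀ a → Tower a → (a ≤ c) ⊎ (f c ≤ a) → (f a ≤ c) ⊎ (f c ≤ f a)
      step a ta (inj₁ a≤c) with em {P = c ≤ a}
      ... | yes c≤a = inj₂ (mono c≤a)
      ... | no c≰a = inj₁ (c-extreme a ta (a≤c , c≰a))
      step a ta (inj₂ fc≤a) = inj₂ (≤-trans fc≤a (tower-inflationary a ta))

      limit : (C : Pred X 0ℓ) → (∀ a → C a → Tower a × ((a ≤ c) ⊎ (f c ≤ a))) →
              IsChain _≤_ C → ∀ s → IsSup _≤_ C s → (s ≤ c) ⊎ (f c ≤ s)
      limit C ih _ s sup with em {P = s ≤ c}
      ... | yes s≤c = inj₁ s≤c
      ... | no s≰c with sup-not-below sup s≰c
      ...   | a , ca , a≰c with proj₂ (ih a ca)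
      ...     | inj₁ a≤c = ⊥-elim (a≰c a≤c)
      ...     | inj₂ fc≤a = inj₂ (≤-trans fc≤a (proj₁ sup a ca))

  tower-extreme : ∀ c → Tower c → IsExtreme c
  tower-extreme = tower-ind IsExtreme step limit
    where
      step : ∀ c → Tower c → IsExtreme c → IsExtreme (f c)
      step c _ c-extreme a ta (a≤fc , fc≰a) with extreme-splits c-extreme a ta
      ... | inj₁ a≤c = mono a≤c
      ... | inj₂ fc≤a = ⊥-elim (fc≰a fc≤a)

      limit : (C : Pred X 0ℓ) → (∀ c → C c → Tower c × IsExtreme c) →
              IsChain _≤_ C → ∀ s → IsSup _≤_ C s → IsExtreme s
      limit C ih _ s sup a ta (_ , s≰a) with sup-not-below sup s≰a
      ... | c , cc , c≰a with extreme-splits (proj₂ (ih c cc)) a ta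
      ...   | inj₁ a≤c = ≤-trans (proj₂ (ih c cc) a ta (a≤c , c≰a)) (proj₁ sup c cc)
      ...   | inj₂ fc≤a = ⊥-elim (c≰a (≤-trans (tower-inflationary c (proj₁ (ih c cc))) fc≤a))

  tower-chain : IsChain _≤_ Tower
  tower-chain a b ta tb with extreme-splits (tower-extreme b tb) a ta
  ... | inj₁ a≤b = inj₁ a≤b
  ... | inj₂ fb≤a = inj₂ (≤-trans (tower-inflationary b tb) fb≤a)

  tower-below-prefixed : ∀ a → Tower a → ∀ y → f y ≤ y → a ≤ y
  tower-below-prefixed = tower-ind (λ a → ∀ y → f y ≤ y → a ≤ y)
    (λ _ _ ih y fy≤y → ≤-trans (mono (ih y fy≤y)) fy≤y)
    (λ C ih _ s (_ , least) y fy≤y → least y λ a ca → proj₂ (ih a ca) y fy≤y)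

  leastPrefixedPoint : ∃ (IsLeastPrefixedPoint _≤_ f)
  leastPrefixedPoint = m , proj₁ sup (f m) (fromWitness (tower-f tm)) , tower-below-prefixed m tm
    where
      Tower₀ : Pred X 0ℓ
      Tower₀ a = Resize (Tower a)

      chain₀ : IsChain _≤_ Tower₀
      chain₀ a b ta tb = tower-chain a b (toWitness ta) (toWitness tb)

      m = proj₁ (complete Tower₀ chain₀)
      sup = proj₂ (complete Tower₀ chain₀)

      tm : Tower m
      tm = tower-sup Tower₀ (λ _ → toWitness) chain₀ m sup

module _ {c ℓ r} (M : RawMonoid c ℓ) (_⊑_ : Rel (RawMonoid.Carrier M) r) where
  open RawMonoid M using (Carrier; _∙_)
  open RawMonoidDefinitions M using (sum)

  sum-mono : Reflexive _⊑_ → (∀ {a a′ b b′} → a ⊑ a′ → b ⊑ b′ → (a ∙ b) ⊑ (a′ ∙ b′)) →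
             ∀ {n} {f g : Fin n → Carrier} → (∀ i → f i ⊑ g i) → sum f ⊑ sum g
  sum-mono ⊑-refl ∙-mono {zero} f⊑g = ⊑-refl
  sum-mono ⊑-refl ∙-mono {suc n} f⊑g =
    ∙-mono (f⊑g zero) (sum-mono ⊑-refl ∙-mono (λ i → f⊑g (suc i)))

module NaturalOrder {c ℓ} (K : CommutativeSemiring c ℓ) where
  open CommutativeSemiring K
  open import Relation.Binary.Reasoning.Setoid setoid

  infix 4 _≼_
  _≼_ : Rel Carrier (c ⊔ ℓ)
  _≼_ = Defs._≼_ K

  ≈⇒≼ : ∀ {a b} → a ≈ b → a ≼ b
  ≈⇒≼ {a} a≈b = 0# , trans (+-identityʳ a) a≈b

  ≼-refl : Reflexive _≼_
  ≼-refl = ≈⇒≼ refl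

  ≼-trans : Transitive _≼_
  ≼-trans {a} {b} {e} (d , a+d≈b) (d′ , b+d′≈e) = d + d′ , (begin
    a + (d + d′)  ≈⟨ sym (+-assoc a d d′) ⟩
    (a + d) + d′  ≈⟨ +-congʳ a+d≈b ⟩
    b + d′        ≈⟨ b+d′≈e ⟩
    e             ∎)

  +-monoˡ-≼ : ∀ {a a′ b} → a ≼ a′ → a + b ≼ a′ + b
  +-monoˡ-≼ {a} {a′} {b} (d , a+d≈a′) = d , (begin
    (a + b) + d  ≈⟨ +-assoc a b d ⟩
    a + (b + d)  ≈⟨ +-congˡ (+-comm b d) ⟩
    a + (d + b)  ≈⟨ sym (+-assoc a d b) ⟩
    (a + d) + b  ≈⟨ +-congʳ a+d≈a′ ⟩
    a′ + b       ∎)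

  *-monoˡ-≼ : ∀ {a a′ b} → a ≼ a′ → a * b ≼ a′ * b
  *-monoˡ-≼ {a} {a′} {b} (d , a+d≈a′) = d * b , (begin
    a * b + d * b  ≈⟨ sym (distribʳ b a d) ⟩
    (a + d) * b    ≈⟨ *-congʳ a+d≈a′ ⟩
    a′ * b         ∎)

  monoˡ⇒mono : ∀ {_∙_ : Carrier → Carrier → Carrier} → (∀ a b → (a ∙ b) ≈ (b ∙ a)) → (∀ {a a′ b} → a ≼ a′ → (a ∙ b) ≼ (a′ ∙ b)) →
               ∀ {a a′ b b′} → a ≼ a′ → b ≼ b′ → (a ∙ b) ≼ (a′ ∙ b′)
  monoˡ⇒mono comm monoˡ {a′ = a′} {b} {b′} a≼a′ b≼b′ =
    ≼-trans (monoˡ a≼a′) (≼-trans (≈⇒≼ (comm a′ b)) (≼-trans (monoˡ b≼b′) (≈⇒≼ (comm b′ a′))))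

  +-mono-≼ : ∀ {a a′ b b′} → a ≼ a′ → b ≼ b′ → a + b ≼ a′ + b′
  +-mono-≼ = monoˡ⇒mono {_+_} +-comm +-monoˡ-≼

  *-mono-≼ : ∀ {a a′ b b′} → a ≼ a′ → b ≼ b′ → a * b ≼ a′ * b′
  *-mono-≼ = monoˡ⇒mono {_*_} *-comm *-monoˡ-≼

  ∑-mono-≼ : ∀ {n} {f g : Fin n → Carrier} → (∀ i → f i ≼ g i) → ∑ K f ≼ ∑ K g
  ∑-mono-≼ f≼g = sum-mono +-rawMonoid _≼_ ≼-refl +-mono-≼ f≼g

  ∏-mono-≼ : ∀ {n} {f g : Fin n → Carrier} → (∀ i → f i ≼ g i) → ∏ K f ≼ ∏ K g
  ∏-mono-≼ f≼g = sum-mono *-rawMonoid _≼_ ≼-refl *-mono-≼ f≼g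

module MonotoneSemantics (em : ∀ {a} → ExcludedMiddle a)
  {c ℓ} (K : CommutativeSemiring c ℓ)
  (antisym : IsNaturallyOrdered K) (complete : FullyChainComplete K)
  (N r : ℕ) (ar : Fin r → ℕ) (π : Lit N r ar → CommutativeSemiring.Carrier K) where

  open CommutativeSemiring K using (Carrier; _≈_; _+_; _*_; refl; sym)
  open Semantics K N r ar π
  open NaturalOrder K

  _≤ₑ_ : ∀ {Δ} → Rel (REnv Δ) (c ⊔ ℓ)
  _≤ₑ_ {Δ} σ σ′ = ∀ {k} (X : k ∈ Δ) → All.lookup σ X ≤f All.lookup σ′ X

  ≤ₑ-refl : ∀ {Δ} {σ : REnv Δ} → σ ≤ₑ σ
  ≤ₑ-refl X ā = ≼-refl

  ∷-mono-≤ₑ : ∀ {k Δ} {g h : RVal k} {σ σ′ : REnv Δ} → g ≤f h → σ ≤ₑ σ′ → (g ∷ σ) ≤ₑ (h ∷ σ′)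
  ∷-mono-≤ₑ g≤h σ≤σ′ (here ≡.refl) = g≤h
  ∷-mono-≤ₑ g≤h σ≤σ′ (there X) = σ≤σ′ X

  Monotone : ∀ {n Δ} → SemFun n Δ → Set (c ⊔ ℓ)
  Monotone f = ∀ {σ σ′} → σ ≤ₑ σ′ → ∀ ρ → f σ ρ ≼ f σ′ ρ

  Update-mono : ∀ {n m Δ} (f : SemFun (m ℕ+ n) (m ∷ Δ)) → Monotone f →
                ∀ {σ σ′} → σ ≤ₑ σ′ → ∀ ρ {g h} → g ≤f h → Update f σ ρ g ≤f Update f σ′ ρ h
  Update-mono _ f-mono σ≤σ′ ρ g≤h ā = f-mono (∷-mono-≤ₑ g≤h σ≤σ′) (ā ++ ρ)

  -- Instantiated with the natural order for lfp and with its converse for gfp.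
  module ExtremalFixedPoint (_⊑_ : Rel Carrier (c ⊔ ℓ)) (⊑-trans : Transitive _⊑_)
    (⊑-antisym : ∀ {a b} → a ⊑ b → b ⊑ a → a ≈ b) (≈⇒⊑ : ∀ {a b} → a ≈ b → a ⊑ b)
    (⊑-complete : ChainComplete _⊑_ c) where

    _⊑f_ : ∀ {m} → Rel (RVal m) (c ⊔ ℓ)
    g ⊑f h = ∀ ā → g ā ⊑ h ā

    ⊑f-trans : ∀ {m} → Transitive (_⊑f_ {m})
    ⊑f-trans g⊑h h⊑k ā = ⊑-trans (g⊑h ā) (h⊑k ā)

    leastPrefixedPoint : ∀ {m} (F : RVal m → RVal m) → (∀ {g h} → g ⊑f h → F g ⊑f F h) →
                         ∃ (IsLeastPrefixedPoint _⊑f_ F)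
    leastPrefixedPoint F F-mono = MonotoneFixedPoint.leastPrefixedPoint em ⊑f-trans
      (chainComplete-pointwise ⊑-complete) F-mono

    leastPrefixedPoint-extremal : ∀ {m} {F : RVal m → RVal m} {g} → (∀ {g h} → g ⊑f h → F g ⊑f F h) →
                                  IsLeastPrefixedPoint _⊑f_ F g →
                                  IsFixedPoint F g × (∀ h → IsFixedPoint F h → g ⊑f h)
    leastPrefixedPoint-extremal F-mono isLeast@(Fg⊑g , least) =
      (λ ā → ⊑-antisym (Fg⊑g ā) (leastPrefixedPoint-postfixed {_≤_ = _⊑f_} F-mono isLeast ā)) ,
      (λ h Fh≈h → least h λ ā → ≈⇒⊑ (Fh≈h ā))

  module Least = ExtremalFixedPoint _≼_ ≼-trans (antisym _ _) ≈⇒≼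
    (λ C chain → proj₁ (complete C chain))
  module Greatest = ExtremalFixedPoint (flip _≼_) (flip ≼-trans) (flip (antisym _ _)) (λ e → ≈⇒≼ (sym e))
    (λ C chain → proj₂ (complete C (flip-isChain chain)))

  record IsMonotoneSemantics {n Δ} (φ : Formula N r ar n Δ) : Set (c ⊔ ℓ) where
    field
      value : SemFun n Δ
      isSem : IsSem φ value
      monotone : Monotone value

  open IsMonotoneSemantics

  independent : ∀ {n Δ} {φ : Formula N r ar n Δ} (v : Env n → Carrier) →
                IsSem φ (λ _ → v) → IsMonotoneSemantics φ
  independent v isSem = record { value = λ _ → v ; isSem = isSem ; monotone = λ _ _ → ≼-refl }

  semantics : ∀ {n Δ} (φ : Formula N r ar n Δ) → IsMonotoneSemantics φ
  semantics (rel R ts) = independent (λ ρ → π (pos R (⟦ ts ⟧ts ρ))) λ _ _ → refl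
  semantics (nrel R ts) = independent (λ ρ → π (neg R (⟦ ts ⟧ts ρ))) λ _ _ → refl
  semantics (eq s t) = independent (λ ρ → π (eqL (⟦ s ⟧t ρ) (⟦ t ⟧t ρ))) λ _ _ → refl
  semantics (neq s t) = independent (λ ρ → π (neqL (⟦ s ⟧t ρ) (⟦ t ⟧t ρ))) λ _ _ → refl
  semantics (rvar X ts) = record
    { value = λ σ ρ → All.lookup σ X (⟦ ts ⟧ts ρ)
    ; isSem = λ _ _ → refl
    ; monotone = λ σ≤σ′ ρ → σ≤σ′ X (⟦ ts ⟧ts ρ) }
  semantics (φ ∨ ψ) = record
    { value = λ σ ρ → value Sφ σ ρ + value Sψ σ ρ
    ; isSem = _ , _ , isSem Sφ , isSem Sψ , λ _ _ → refl
    ; monotone = λ σ≤σ′ ρ → +-mono-≼ (monotone Sφ σ≤σ′ ρ) (monotone Sψ σ≤σ′ ρ) }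
    where Sφ = semantics φ
          Sψ = semantics ψ
  semantics (φ ∧ ψ) = record
    { value = λ σ ρ → value Sφ σ ρ * value Sψ σ ρ
    ; isSem = _ , _ , isSem Sφ , isSem Sψ , λ _ _ → refl
    ; monotone = λ σ≤σ′ ρ → *-mono-≼ (monotone Sφ σ≤σ′ ρ) (monotone Sψ σ≤σ′ ρ) }
    where Sφ = semantics φ
          Sψ = semantics ψ
  semantics (ex φ) = record
    { value = λ σ ρ → ∑ K λ a → value Sφ σ (a ∷ ρ)
    ; isSem = _ , isSem Sφ , λ _ _ → refl
    ; monotone = λ σ≤σ′ ρ → ∑-mono-≼ λ a → monotone Sφ σ≤σ′ (a ∷ ρ) }
    where Sφ = semantics φ
  semantics (all φ) = record
    { value = λ σ ρ → ∏ K λ a → value Sφ σ (a ∷ ρ)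
    ; isSem = _ , isSem Sφ , λ _ _ → refl
    ; monotone = λ σ≤σ′ ρ → ∏-mono-≼ λ a → monotone Sφ σ≤σ′ (a ∷ ρ) }
    where Sφ = semantics φ
  semantics (lfp m φ ts) = record
    { value = λ σ ρ → proj₁ (lfpOf σ ρ) (⟦ ts ⟧ts ρ)
    ; isSem = _ , isSem Sφ , λ σ ρ →
        proj₁ (lfpOf σ ρ) , Least.leastPrefixedPoint-extremal (F-mono σ ρ) (proj₂ (lfpOf σ ρ)) , refl
    ; monotone = lfp-mono }
    where
      Sφ = semantics φ
      F-mono : ∀ σ ρ {g h : RVal m} → g ≤f h → Update (value Sφ) σ ρ g ≤f Update (value Sφ) σ ρ h
      F-mono σ ρ = Update-mono (value Sφ) (monotone Sφ) (≤ₑ-refl {σ = σ}) ρ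
      lfpOf : ∀ σ ρ → ∃ (IsLeastPrefixedPoint _≤f_ (Update (value Sφ) σ ρ))
      lfpOf σ ρ = Least.leastPrefixedPoint _ (F-mono σ ρ)
      lfp-mono : Monotone λ σ ρ → proj₁ (lfpOf σ ρ) (⟦ ts ⟧ts ρ)
      lfp-mono {σ} {σ′} σ≤σ′ ρ = leastPrefixedPoint-mono {_≤_ = _≤f_} Least.⊑f-trans
        (λ _ → Update-mono (value Sφ) (monotone Sφ) σ≤σ′ ρ (λ _ → ≼-refl))
        (proj₂ (lfpOf σ ρ)) (proj₂ (lfpOf σ′ ρ)) (⟦ ts ⟧ts ρ)
  semantics (gfp m φ ts) = record
    { value = λ σ ρ → proj₁ (gfpOf σ ρ) (⟦ ts ⟧ts ρ)
    ; isSem = _ , isSem Sφ , λ σ ρ →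
        proj₁ (gfpOf σ ρ) , Greatest.leastPrefixedPoint-extremal (F-mono σ ρ) (proj₂ (gfpOf σ ρ)) , refl
    ; monotone = gfp-mono }
    where
      Sφ = semantics φ
      F-mono : ∀ σ ρ {g h : RVal m} → h ≤f g → Update (value Sφ) σ ρ h ≤f Update (value Sφ) σ ρ g
      F-mono σ ρ = Update-mono (value Sφ) (monotone Sφ) (≤ₑ-refl {σ = σ}) ρ
      gfpOf : ∀ σ ρ → ∃ (IsLeastPrefixedPoint Greatest._⊑f_ (Update (value Sφ) σ ρ))
      gfpOf σ ρ = Greatest.leastPrefixedPoint _ (F-mono σ ρ)
      gfp-mono : Monotone λ σ ρ → proj₁ (gfpOf σ ρ) (⟦ ts ⟧ts ρ)
      gfp-mono {σ} {σ′} σ≤σ′ ρ = leastPrefixedPoint-mono {_≤_ = Greatest._⊑f_} Greatest.⊑f-trans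
        (λ _ → Update-mono (value Sφ) (monotone Sφ) σ≤σ′ ρ (λ _ → ≼-refl))
        (proj₂ (gfpOf σ′ ρ)) (proj₂ (gfpOf σ ρ)) (⟦ ts ⟧ts ρ)

theorem7 : (∀ {a} → ExcludedMiddle a) →
           ∀ {c ℓ} (K : CommutativeSemiring c ℓ) →
           ZeroNotOne K → IsNaturallyOrdered K → FullyChainComplete K →
           (N r : ℕ) (ar : Fin r → ℕ) →
           (π : Lit N r ar → CommutativeSemiring.Carrier K) →
           IsKInterpretation K N r ar π →
           ∀ {n} {Δ} (φ : Formula N r ar n Δ) →
           Σ (Semantics.SemFun K N r ar π n Δ) (Semantics.IsSem K N r ar π φ)
theorem7 em K _ antisym complete N r ar π _ φ = value S , isSem S
  where
    open MonotoneSemantics em K antisym complete N r ar π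
    open IsMonotoneSemantics
    S = semantics φ
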